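{- For every $n\ge 2$ there exists an asynchronous mutual search algorithm for two agents on $n$ sites with cost at most $\frac{5-\sqrt{2}}{4}\,n$ (approximately $0.896n$).
   Context: An asynchronous mutual search (AMS) algorithm for two agents on sites $V=\{0,\ldots,n-1\}$ consists of a tournament $(V,E)$ ($E$ contains, for each unordered pair $\{i,j\}$ of distinct sites, exactly one of the arcs $(i,j)$, $(j,i)$; arc $(i,j)$ means that an agent at $i$ queries $j$) together with, for each site $i$, a total order on its row $E_i$ (the set of arcs leaving $i$), giving the order in which an agent at $i$ makes its queries; arcs in different rows are not ordered relative to each other. The cost of an arc $e=(i,j)\in E_i$ is its position in the order of $E_i$ (the first arc of the row having position $1$) plus the length $|E_j|$ of the row of its target. The cost of the AMS algorithm is the maximum cost over all its arcs. -}

module Defs where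

open import Data.Nat using (ℕ; suc; _+_; _*_; _∸_; _≤_; _⊔_)
open import Data.Fin using (Fin)
open import Data.List using (List; []; _∷_; length; foldr; allFin)
open import Data.List.Membership.Propositional using (_∈_; _∉_)
open import Data.List.Relation.Unary.Unique.Propositional using (Unique)
open import Data.Product using (_×_)
open import Data.Sum using (_⊎_)
open import Relation.Binary.PropositionalEquality using (_≢_)

-- An AMS algorithm on n sites: for each site i, its row E_i listed in
-- query order (first element = position 1).  The tournament is given by
-- (i , j) ∈ E  iff  j ∈ row i.
record AMS (n : ℕ) : Set where
  field
    row        : Fin n → List (Fin n)
    row-unique : ∀ i → Unique (row i)
    irreflexive : ∀ i → i ∉ row i
    tournament : ∀ i j → i ≢ j →
                 (j ∈ row i × i ∉ row j) ⊎ (i ∈ row j × j ∉ row i)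

module _ {n : ℕ} (A : AMS n) where
  open AMS A

  rowLength : Fin n → ℕ
  rowLength j = length (row j)

  costFrom : ℕ → List (Fin n) → ℕ
  costFrom p []       = 0
  costFrom p (j ∷ js) = (p + rowLength j) ⊔ costFrom (suc p) js

  rowCost : Fin n → ℕ
  rowCost i = costFrom 1 (row i)

  cost : ℕ
  cost = foldr (λ i m → rowCost i ⊔ m) 0 (allFin n)

-- c ≤ ((5 - √2)/4) · n, stated exactly over ℕ:
-- 4c ≤ 5n  and  2 n² ≤ (5n - 4c)²   (equivalent to √2 n ≤ 5n - 4c)
AtMostBound : ℕ → ℕ → Set
AtMostBound c n = (4 * c ≤ 5 * n) × (2 * (n * n) ≤ (5 * n ∸ 4 * c) * (5 * n ∸ 4 * c))

-- Split the sites into a lower tier of 2b sites, a middle tier of L sites and an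
-- upper tier of b sites.  Lower sites query all upper sites; every other pair is
-- oriented by the alternating tournament, in which a site queries exactly one of
-- any two consecutive sites on the same side of it, so that out-degrees are about
-- half of the sites competing with it.  Every site queries in increasing order.
-- Bounding, tier by tier, how many queries precede a query into a tier and the
-- out-degree of its target bounds the cost by roughly 7n/8, and the bound grows by
-- at most 7 when b and L grow by 2, i.e. when n grows by 8.  Since 7/8 < (5 - √2)/4,
-- finitely many base cases checked by computation cover every n ≥ 2.
module Submission where

open import Defs
open import Data.Bool using (Bool; true; false; not; if_then_else_; T)
open import Data.Bool.Properties using (not-involutive)
open import Data.Fin using (Fin; toℕ)
open import Data.Fin.Properties using (toℕ-injective; toℕ<n)
open import Data.List using (List; []; _∷_; _++_; length; map; filterᵇ; allFin; tabulate; foldr)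
open import Data.List.Properties using (length-++; length-map; filter-++; map-tabulate; tabulate-cong)
open import Data.List.Membership.Propositional using (_∈_; _∉_)
open import Data.List.Membership.Propositional.Properties using (∈-filter⁺; ∈-filter⁻; ∈-allFin)
open import Data.List.Relation.Unary.Any using (here; there)
open import Data.List.Relation.Unary.Unique.Propositional.Properties using (allFin⁺; filter⁺)
open import Data.Nat
  using (ℕ; zero; suc; _+_; _*_; _∸_; _≤_; _<_; _≥_; _⊔_; z≤n; s≤s; z<s; _≤?_; _<?_; ⌊_/2⌋; ⌈_/2⌉)
open import Data.Nat.Properties
open import Data.Nat.DivMod using (_/_; _%_; m%n<n; m≡m%n+[m/n]*n)
open import Data.Nat.Tactic.RingSolver using (solve-∀)
open import Data.Product using (Σ; _×_; _,_; proj₁; proj₂)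
open import Data.Sum using (_⊎_; inj₁; inj₂)
open import Data.Unit using (tt)
open import Function using (_∘_)
open import Relation.Binary using (tri<; tri≈; tri>)
open import Relation.Binary.PropositionalEquality
open import Relation.Nullary using (Dec; does; yes; no; contradiction)
open import Relation.Nullary.Decidable using (True; toWitness; dec-true; dec-false; _×-dec_; T?)

2*m≤n⇒m≤⌊n/2⌋ : ∀ {m n} → 2 * m ≤ n → m ≤ ⌊ n /2⌋
2*m≤n⇒m≤⌊n/2⌋ {zero}  _ = z≤n
2*m≤n⇒m≤⌊n/2⌋ {suc m} {n} 2+2m≤n with subst (_≤ n) (*-suc 2 m) 2+2m≤n
... | s≤s (s≤s 2m≤n) = s≤s (2*m≤n⇒m≤⌊n/2⌋ 2m≤n)

map-filterᵇ : ∀ {A B : Set} (f : A → B) (p : B → Bool) xs →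
              map f (filterᵇ (p ∘ f) xs) ≡ filterᵇ p (map f xs)
map-filterᵇ f p []       = refl
map-filterᵇ f p (x ∷ xs) with p (f x)
... | true  = cong (f x ∷_) (map-filterᵇ f p xs)
... | false = map-filterᵇ f p xs

filterᵇ-cong : ∀ {A : Set} {p q : A → Bool} xs → (∀ {v} → v ∈ xs → p v ≡ q v) →
               filterᵇ p xs ≡ filterᵇ q xs
filterᵇ-cong []       _   = refl
filterᵇ-cong {q = q} (x ∷ xs) p≗q rewrite p≗q (here refl) with q x
... | true  = cong (x ∷_) (filterᵇ-cong xs (p≗q ∘ there))
... | false = filterᵇ-cong xs (p≗q ∘ there)

interval : ℕ → ℕ → List ℕ
interval lo zero    = []
interval lo (suc k) = lo ∷ interval (suc lo) k

interval-++ : ∀ lo k l → interval lo (k + l) ≡ interval lo k ++ interval (lo + k) l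
interval-++ lo zero    l rewrite +-identityʳ lo = refl
interval-++ lo (suc k) l rewrite +-suc lo k = cong (lo ∷_) (interval-++ (suc lo) k l)

∈-interval⁻ : ∀ {v} lo k → v ∈ interval lo k → lo ≤ v × v < lo + k
∈-interval⁻ lo (suc k) (here refl) = ≤-refl , m<m+n lo z<s
∈-interval⁻ {v} lo (suc k) (there v∈) with ∈-interval⁻ (suc lo) k v∈
... | lo<v , v<lo+k = <⇒≤ lo<v , subst (v <_) (sym (+-suc lo k)) v<lo+k

∈-filterᵇ-interval⁻ : ∀ {p v} lo k → v ∈ filterᵇ p (interval lo k) → lo ≤ v × v < lo + k
∈-filterᵇ-interval⁻ {p} lo k v∈ = ∈-interval⁻ lo k (proj₁ (∈-filter⁻ (T? ∘ p) v∈))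

tabulate-interval : ∀ {k} lo → tabulate (λ (i : Fin k) → lo + toℕ i) ≡ interval lo k
tabulate-interval {zero}  lo = refl
tabulate-interval {suc k} lo = cong₂ _∷_ (+-identityʳ lo)
  (trans (tabulate-cong (λ i → +-suc lo (toℕ i))) (tabulate-interval (suc lo)))

map-toℕ-allFin : ∀ n → map toℕ (allFin n) ≡ interval 0 n
map-toℕ-allFin n = trans (map-tabulate (λ i → i) toℕ) (tabulate-interval 0)

count : (ℕ → Bool) → ℕ → ℕ → ℕ
count p lo k = length (filterᵇ p (interval lo k))

filterᵇ-interval-++ : ∀ p lo k l → filterᵇ p (interval lo (k + l)) ≡
                      filterᵇ p (interval lo k) ++ filterᵇ p (interval (lo + k) l)
filterᵇ-interval-++ p lo k l =
  trans (cong (filterᵇ p) (interval-++ lo k l)) (filter-++ (T? ∘ p) (interval lo k) _)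

count-++ : ∀ p lo k l → count p lo (k + l) ≡ count p lo k + count p (lo + k) l
count-++ p lo k l =
  trans (cong length (filterᵇ-interval-++ p lo k l)) (length-++ (filterᵇ p (interval lo k)))

count-≤ : ∀ p lo k → count p lo k ≤ k
count-≤ p lo zero = z≤n
count-≤ p lo (suc k) with p lo
... | true  = s≤s (count-≤ p (suc lo) k)
... | false = m≤n⇒m≤1+n (count-≤ p (suc lo) k)

count-const-false : ∀ lo k → count (λ _ → false) lo k ≡ 0
count-const-false lo zero    = refl
count-const-false lo (suc k) = count-const-false (suc lo) k

count-cong : ∀ {p q} lo k → (∀ {v} → lo ≤ v → v < lo + k → p v ≡ q v) → count p lo k ≡ count q lo k
count-cong lo k p≗q = cong length (filterᵇ-cong (interval lo k) λ v∈ →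
  let lo≤v , v<lo+k = ∈-interval⁻ lo k v∈ in p≗q lo≤v v<lo+k)

count-skip : ∀ p lo k → p lo ≡ false → count p lo (suc k) ≡ count p (suc lo) k
count-skip p lo k plo rewrite plo = refl

count-shift : ∀ p c lo k → count (λ v → p (c + v)) lo k ≡ count p (c + lo) k
count-shift p c lo zero = refl
count-shift p c lo (suc k) with p (c + lo)
... | true  = cong suc (trans (count-shift p c (suc lo) k) (cong (λ s → count p s k) (+-suc c lo)))
... | false = trans (count-shift p c (suc lo) k) (cong (λ s → count p s k) (+-suc c lo))

even : ℕ → Bool
even zero          = true
even (suc zero)    = false
even (suc (suc n)) = even n

even-suc : ∀ n → even (suc n) ≡ not (even n)
even-suc zero          = refl
even-suc (suc zero)    = refl
even-suc (suc (suc n)) = even-suc n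

count-even-periodic : ∀ s k → count even (2 + s) k ≡ count even s k
count-even-periodic s zero = refl
count-even-periodic s (suc k) with even s
... | true  = cong suc (count-even-periodic (suc s) k)
... | false = count-even-periodic (suc s) k

count-even-double : ∀ c s k → count even (c + c + s) k ≡ count even s k
count-even-double zero    s k = refl
count-even-double (suc c) s k = begin
  count even (suc (c + suc c + s)) k ≡⟨ cong (λ x → count even (suc (x + s)) k) (+-suc c c) ⟩
  count even (2 + (c + c + s)) k     ≡⟨ count-even-periodic (c + c + s) k ⟩
  count even (c + c + s) k           ≡⟨ count-even-double c s k ⟩
  count even s k                     ∎
  where open ≡-Reasoning

count-even-pair : ∀ s k → count even s (2 + k) ≡ suc (count even (2 + s) k)
count-even-pair s k with even s | even-suc s
... | true  | e rewrite e = refl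
... | false | e rewrite e = refl

count-even-≤ : ∀ s k → 2 * count even s k ≤ suc k
count-even-≤ s zero = z≤n
count-even-≤ s (suc zero) with even s
... | true  = ≤-refl
... | false = z≤n
count-even-≤ s (suc (suc k))
  rewrite count-even-pair s k | count-even-periodic s k | *-suc 2 (count even s k)
  = s≤s (s≤s (count-even-≤ s k))

count-even-diagonal : ∀ k → 2 * count even k k ≤ k
count-even-diagonal zero          = z≤n
count-even-diagonal (suc zero)    = z≤n
count-even-diagonal (suc (suc k))
  rewrite count-even-pair (2 + k) k | count-even-periodic (2 + k) k | count-even-periodic k k
        | *-suc 2 (count even k k)
  = s≤s (s≤s (count-even-diagonal k))

-- Of any two consecutive sites on the same side of u, u queries exactly one.
alternating : ℕ → ℕ → Bool
alternating u v =
  if does (u <? v) then not (even (u + v)) else if does (v <? u) then even (u + v) else false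

alternating-above : ∀ {u v} → u < v → alternating u v ≡ not (even (u + v))
alternating-above {u} {v} u<v rewrite dec-true (u <? v) u<v = refl

alternating-below : ∀ {u v} → v < u → alternating u v ≡ even (u + v)
alternating-below {u} {v} v<u rewrite dec-false (u <? v) (<⇒≯ v<u) | dec-true (v <? u) v<u = refl

alternating-irrefl : ∀ u → alternating u u ≡ false
alternating-irrefl u rewrite dec-false (u <? u) (<-irrefl refl) = refl

alternating-antisym : ∀ u v → u ≢ v → alternating v u ≡ not (alternating u v)
alternating-antisym u v u≢v with <-cmp u v
... | tri< u<v _ _
  rewrite alternating-below u<v | alternating-above u<v | +-comm v u = sym (not-involutive _)
... | tri≈ _ u≡v _ = contradiction u≡v u≢v
... | tri> _ _ v<u
  rewrite alternating-above v<u | alternating-below v<u | +-comm v u = refl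

count-alternating-below : ∀ {u} lo k → lo + k ≤ u → count (alternating u) lo k ≤ ⌈ k /2⌉
count-alternating-below {u} lo k lo+k≤u = 2*m≤n⇒m≤⌊n/2⌋ (begin
  2 * count (alternating u) lo k      ≡⟨ cong (2 *_) (count-cong lo k λ _ v<lo+k →
                                           alternating-below (<-≤-trans v<lo+k lo+k≤u)) ⟩
  2 * count (λ v → even (u + v)) lo k ≡⟨ cong (2 *_) (count-shift even u lo k) ⟩
  2 * count even (u + lo) k           ≤⟨ count-even-≤ (u + lo) k ⟩
  suc k                               ∎)
  where open ≤-Reasoning

private
  -- The x sites below u contribute at most ⌊ x /2⌋ queries, the y sites above u at most ⌈ y /2⌉.
  count-alternating-split : ∀ lo x y →
    2 * count (alternating (lo + x)) lo (x + suc y) ≤ x + suc y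
  count-alternating-split lo x y = begin
    2 * count (alternating u) lo (x + suc y)
      ≡⟨ cong (2 *_) (count-++ (alternating u) lo x (suc y)) ⟩
    2 * (count (alternating u) lo x + count (alternating u) u (suc y))
      ≡⟨ cong (2 *_) (cong₂ _+_ below above) ⟩
    2 * (count even x x + count even 0 y)
      ≡⟨ *-distribˡ-+ 2 (count even x x) _ ⟩
    2 * count even x x + 2 * count even 0 y
      ≤⟨ +-mono-≤ (count-even-diagonal x) (count-even-≤ 0 y) ⟩
    x + suc y ∎
    where
    open ≤-Reasoning
    u = lo + x

    below : count (alternating u) lo x ≡ count even x x
    below = begin-equality
      count (alternating u) lo x      ≡⟨ count-cong lo x (λ _ v<u → alternating-below v<u) ⟩
      count (λ v → even (u + v)) lo x ≡⟨ count-shift even u lo x ⟩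
      count even (u + lo) x           ≡⟨ cong (λ s → count even s x) (reorder lo x) ⟩
      count even (lo + lo + x) x      ≡⟨ count-even-double lo x x ⟩
      count even x x                  ∎
      where
      reorder : ∀ lo x → lo + x + lo ≡ lo + lo + x
      reorder = solve-∀

    above : count (alternating u) u (suc y) ≡ count even 0 y
    above = begin-equality
      count (alternating u) u (suc y)      ≡⟨ count-skip (alternating u) u y (alternating-irrefl u) ⟩
      count (alternating u) (suc u) y      ≡⟨ count-cong (suc u) y (λ u<v _ →
                                                trans (alternating-above u<v) (sym (even-suc (u + _)))) ⟩
      count (λ v → even (suc u + v)) (suc u) y ≡⟨ count-shift even (suc u) (suc u) y ⟩
      count even (suc u + suc u) y         ≡⟨ cong (λ s → count even s y) (sym (+-identityʳ _)) ⟩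
      count even (suc u + suc u + 0) y     ≡⟨ count-even-double (suc u) 0 y ⟩
      count even 0 y                       ∎

count-alternating-around : ∀ {u} lo k → lo ≤ u → u < lo + k → count (alternating u) lo k ≤ ⌊ k /2⌋
count-alternating-around {u} lo k lo≤u u<lo+k = 2*m≤n⇒m≤⌊n/2⌋
  (subst₂ (λ u k → 2 * count (alternating u) lo k ≤ k) lo+x≡u x+1+y≡k (count-alternating-split lo x y))
  where
  x = u ∸ lo
  lo+x≡u : lo + x ≡ u
  lo+x≡u = m+[n∸m]≡n lo≤u
  x<k : x < k
  x<k = +-cancelˡ-< lo x k (subst (_< lo + k) (sym lo+x≡u) u<lo+k)
  y = k ∸ suc x
  x+1+y≡k : x + suc y ≡ k
  x+1+y≡k = trans (+-suc x y) (m+[n∸m]≡n x<k)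

module IncreasingOrder (n : ℕ) (arc : ℕ → ℕ → Bool)
  (arc-irrefl : ∀ u → arc u u ≡ false)
  (arc-antisym : ∀ u v → u ≢ v → arc v u ≡ not (arc u v)) where

  row : Fin n → List (Fin n)
  row i = filterᵇ (arc (toℕ i) ∘ toℕ) (allFin n)

  ∈-row⁺ : ∀ {i} j → arc (toℕ i) (toℕ j) ≡ true → j ∈ row i
  ∈-row⁺ {i} j ij = ∈-filter⁺ (T? ∘ (arc (toℕ i) ∘ toℕ)) (∈-allFin j) (subst T (sym ij) tt)

  ∉-row : ∀ {i} j → arc (toℕ i) (toℕ j) ≡ false → j ∉ row i
  ∉-row {i} j ij j∈ = subst T ij (proj₂ (∈-filter⁻ (T? ∘ (arc (toℕ i) ∘ toℕ)) {xs = allFin n} j∈))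

  ams : AMS n
  ams = record
    { row         = row
    ; row-unique  = λ _ → filter⁺ (T? ∘ _) (allFin⁺ n)
    ; irreflexive = λ i → ∉-row i (arc-irrefl (toℕ i))
    ; tournament  = tournament
    }
    where
    tournament : ∀ i j → i ≢ j → (j ∈ row i × i ∉ row j) ⊎ (i ∈ row j × j ∉ row i)
    tournament i j i≢j
      with arc (toℕ i) (toℕ j) in ij | arc-antisym (toℕ i) (toℕ j) (i≢j ∘ toℕ-injective)
    ... | true  | ji = inj₁ (∈-row⁺ j ij , ∉-row i ji)
    ... | false | ji = inj₂ (∈-row⁺ i ji , ∉-row j ij)

  outs : ℕ → List ℕ
  outs u = filterᵇ (arc u) (interval 0 n)

  outdeg : ℕ → ℕ
  outdeg u = count (arc u) 0 n

  queryCost : ℕ → List ℕ → ℕ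
  queryCost p []       = 0
  queryCost p (v ∷ vs) = (p + outdeg v) ⊔ queryCost (suc p) vs

  map-toℕ-row : ∀ i → map toℕ (row i) ≡ outs (toℕ i)
  map-toℕ-row i = trans (map-filterᵇ toℕ (arc (toℕ i)) (allFin n))
                        (cong (filterᵇ (arc (toℕ i))) (map-toℕ-allFin n))

  rowLength≡outdeg : ∀ j → rowLength ams j ≡ outdeg (toℕ j)
  rowLength≡outdeg j = trans (sym (length-map toℕ (row j))) (cong length (map-toℕ-row j))

  costFrom≡queryCost : ∀ p js → costFrom ams p js ≡ queryCost p (map toℕ js)
  costFrom≡queryCost p []       = refl
  costFrom≡queryCost p (j ∷ js) =
    cong₂ _⊔_ (cong (p +_) (rowLength≡outdeg j)) (costFrom≡queryCost (suc p) js)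

  cost-≤ : ∀ {K} → (∀ u → u < n → queryCost 1 (outs u) ≤ K) → cost ams ≤ K
  cost-≤ {K} rows≤K = foldr-≤ (allFin n)
    where
    rowCost-≤ : ∀ i → rowCost ams i ≤ K
    rowCost-≤ i = subst (_≤ K)
      (sym (trans (costFrom≡queryCost 1 (row i)) (cong (queryCost 1) (map-toℕ-row i))))
      (rows≤K (toℕ i) (toℕ<n i))
    foldr-≤ : ∀ is → foldr (λ i m → rowCost ams i ⊔ m) 0 is ≤ K
    foldr-≤ []       = z≤n
    foldr-≤ (i ∷ is) = ⊔-lub (rowCost-≤ i) (foldr-≤ is)

  queryCost-++ : ∀ p xs ys → queryCost p (xs ++ ys) ≡ queryCost p xs ⊔ queryCost (p + length xs) ys
  queryCost-++ p []       ys = cong (λ q → queryCost q ys) (sym (+-identityʳ p))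
  queryCost-++ p (x ∷ xs) ys = begin
    (p + outdeg x) ⊔ queryCost (suc p) (xs ++ ys)
      ≡⟨ cong ((p + outdeg x) ⊔_) (queryCost-++ (suc p) xs ys) ⟩
    (p + outdeg x) ⊔ (queryCost (suc p) xs ⊔ queryCost (suc p + length xs) ys)
      ≡⟨ sym (⊔-assoc (p + outdeg x) _ _) ⟩
    (p + outdeg x) ⊔ queryCost (suc p) xs ⊔ queryCost (suc p + length xs) ys
      ≡⟨ cong (λ q → (p + outdeg x) ⊔ queryCost (suc p) xs ⊔ queryCost q ys) (sym (+-suc p (length xs))) ⟩
    (p + outdeg x) ⊔ queryCost (suc p) xs ⊔ queryCost (p + suc (length xs)) ys ∎
    where open ≡-Reasoning

  queryCost-≤ : ∀ {D} p xs → (∀ {v} → v ∈ xs → outdeg v ≤ D) → queryCost (suc p) xs ≤ p + length xs + D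
  queryCost-≤ p []       _     = z≤n
  queryCost-≤ {D} p (x ∷ xs) deg≤ = ⊔-lub first rest
    where
    open ≤-Reasoning
    first : suc p + outdeg x ≤ p + suc (length xs) + D
    first = begin
      suc p + outdeg x          ≤⟨ +-monoʳ-≤ (suc p) (deg≤ (here refl)) ⟩
      suc p + D                 ≤⟨ +-monoˡ-≤ D (m≤m+n (suc p) (length xs)) ⟩
      suc p + length xs + D     ≡⟨ cong (_+ D) (sym (+-suc p (length xs))) ⟩
      p + suc (length xs) + D   ∎
    rest : queryCost (suc (suc p)) xs ≤ p + suc (length xs) + D
    rest = subst (λ q → queryCost (suc (suc p)) xs ≤ q + D) (sym (+-suc p (length xs)))
                 (queryCost-≤ (suc p) xs (deg≤ ∘ there))

  queryCost-after : ∀ {D x} xs ys → (∀ {v} → v ∈ ys → outdeg v ≤ D) → length (xs ++ ys) ≤ x →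
                    queryCost (suc (length xs)) ys ≤ x + D
  queryCost-after {D} xs ys deg≤ len≤ =
    ≤-trans (queryCost-≤ (length xs) ys deg≤) (+-monoˡ-≤ D (subst (_≤ _) (length-++ xs) len≤))

  queryCost-segments : ∀ {D₁ D₂ D₃ x₁ x₂ x₃} xs ys zs →
    (∀ {v} → v ∈ xs → outdeg v ≤ D₁) → (∀ {v} → v ∈ ys → outdeg v ≤ D₂) →
    (∀ {v} → v ∈ zs → outdeg v ≤ D₃) →
    length xs ≤ x₁ → length (xs ++ ys) ≤ x₂ → length ((xs ++ ys) ++ zs) ≤ x₃ →
    queryCost 1 ((xs ++ ys) ++ zs) ≤ (x₁ + D₁) ⊔ (x₂ + D₂) ⊔ (x₃ + D₃)
  queryCost-segments xs ys zs deg₁ deg₂ deg₃ len₁ len₂ len₃ = begin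
    queryCost 1 ((xs ++ ys) ++ zs)
      ≡⟨ queryCost-++ 1 (xs ++ ys) zs ⟩
    queryCost 1 (xs ++ ys) ⊔ queryCost (suc (length (xs ++ ys))) zs
      ≡⟨ cong (_⊔ queryCost (suc (length (xs ++ ys))) zs) (queryCost-++ 1 xs ys) ⟩
    queryCost 1 xs ⊔ queryCost (suc (length xs)) ys ⊔ queryCost (suc (length (xs ++ ys))) zs
      ≤⟨ ⊔-mono-≤ (⊔-mono-≤ (queryCost-after [] xs deg₁ len₁) (queryCost-after xs ys deg₂ len₂))
                  (queryCost-after (xs ++ ys) zs deg₃ len₃) ⟩
    _ ∎
    where open ≤-Reasoning

data Tier : Set where
  lower middle upper : Tier

tierArc : Tier → Tier → ℕ → ℕ → Bool
tierArc lower upper _ _ = true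
tierArc upper lower _ _ = false
tierArc _     _     u v = alternating u v

tierArc-irrefl : ∀ t u → tierArc t t u u ≡ false
tierArc-irrefl lower  = alternating-irrefl
tierArc-irrefl middle = alternating-irrefl
tierArc-irrefl upper  = alternating-irrefl

tierArc-antisym : ∀ s t u v → u ≢ v → tierArc t s v u ≡ not (tierArc s t u v)
tierArc-antisym lower  lower  = alternating-antisym
tierArc-antisym lower  middle = alternating-antisym
tierArc-antisym lower  upper  _ _ _ = refl
tierArc-antisym middle lower  = alternating-antisym
tierArc-antisym middle middle = alternating-antisym
tierArc-antisym middle upper  = alternating-antisym
tierArc-antisym upper  lower  _ _ _ = refl
tierArc-antisym upper  middle = alternating-antisym
tierArc-antisym upper  upper  = alternating-antisym

-- The lower tier is [0, a), the middle tier [a, m) and the upper tier [m, N).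
module TierSizes (b L : ℕ) where

  a m N : ℕ
  a = b + b
  m = a + L
  N = m + b

  lowerDeg middleDeg upperDeg : ℕ
  lowerDeg  = ⌊ m /2⌋ + b
  middleDeg = ⌊ N /2⌋
  upperDeg  = ⌊ (L + b) /2⌋

  -- Bounds the cost of a row making at most x₁ queries into the lower tier, at most x₂
  -- into the lower and middle tiers and at most x₃ in total.
  rowBound : ℕ → ℕ → ℕ → ℕ
  rowBound x₁ x₂ x₃ = (x₁ + lowerDeg) ⊔ (x₂ + middleDeg) ⊔ (x₃ + upperDeg)

  lowerRowBound middleRowBound upperRowBound costBound : ℕ
  lowerRowBound  = rowBound ⌈ a /2⌉ ⌊ m /2⌋ lowerDeg
  middleRowBound = rowBound ⌈ a /2⌉ ⌊ m /2⌋ middleDeg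
  upperRowBound  = rowBound 0 ⌈ L /2⌉ upperDeg
  costBound      = lowerRowBound ⊔ middleRowBound ⊔ upperRowBound

module ThreeTier (b L : ℕ) where

  open TierSizes b L

  tier : ℕ → Tier
  tier u = if does (u <? a) then lower else if does (u <? m) then middle else upper

  arc : ℕ → ℕ → Bool
  arc u v = tierArc (tier u) (tier v) u v

  open IncreasingOrder N arc (λ u → tierArc-irrefl (tier u) u) (λ u v → tierArc-antisym (tier u) (tier v) u v)

  threeTier : AMS N
  threeTier = ams

  tier-lower : ∀ {u} → u < a → tier u ≡ lower
  tier-lower {u} u<a rewrite dec-true (u <? a) u<a = refl

  tier-middle : ∀ {u} → a ≤ u → u < m → tier u ≡ middle
  tier-middle {u} a≤u u<m rewrite dec-false (u <? a) (≤⇒≯ a≤u) | dec-true (u <? m) u<m = refl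

  tier-upper : ∀ {u} → m ≤ u → tier u ≡ upper
  tier-upper {u} m≤u
    rewrite dec-false (u <? a) (≤⇒≯ (≤-trans (m≤m+n a L) m≤u)) | dec-false (u <? m) (≤⇒≯ m≤u) = refl

  arc-lowerMiddle : ∀ {u v} → u < m → v < m → arc u v ≡ alternating u v
  arc-lowerMiddle {u} {v} u<m v<m with u <? a | v <? a
  ... | yes u<a | yes v<a rewrite tier-lower u<a | tier-lower v<a = refl
  ... | yes u<a | no v≮a  rewrite tier-lower u<a | tier-middle (≮⇒≥ v≮a) v<m = refl
  ... | no u≮a  | _       rewrite tier-middle (≮⇒≥ u≮a) u<m = refl

  arc-middle : ∀ {u v} → a ≤ u → u < m → arc u v ≡ alternating u v
  arc-middle a≤u u<m rewrite tier-middle a≤u u<m = refl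

  arc-upper-lower : ∀ {u v} → m ≤ u → v < a → arc u v ≡ false
  arc-upper-lower m≤u v<a rewrite tier-upper m≤u | tier-lower v<a = refl

  arc-upper : ∀ {u v} → m ≤ u → a ≤ v → arc u v ≡ alternating u v
  arc-upper {u} {v} m≤u a≤v with v <? m
  ... | yes v<m rewrite tier-upper m≤u | tier-middle a≤v v<m = refl
  ... | no v≮m  rewrite tier-upper m≤u | tier-upper (≮⇒≥ v≮m) = refl

  arcCount-around : ∀ {u} lo k → (∀ {v} → lo ≤ v → v < lo + k → arc u v ≡ alternating u v) →
                    lo ≤ u → u < lo + k → count (arc u) lo k ≤ ⌊ k /2⌋
  arcCount-around lo k agree lo≤u u<lo+k =
    subst (_≤ _) (sym (count-cong lo k agree)) (count-alternating-around lo k lo≤u u<lo+k)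

  arcCount-below : ∀ {u} lo k → (∀ {v} → lo ≤ v → v < lo + k → arc u v ≡ alternating u v) →
                   lo + k ≤ u → count (arc u) lo k ≤ ⌈ k /2⌉
  arcCount-below lo k agree lo+k≤u =
    subst (_≤ _) (sym (count-cong lo k agree)) (count-alternating-below lo k lo+k≤u)

  record QueryProfile (u x₁ x₂ x₃ : ℕ) : Set where
    field
      intoLower       : count (arc u) 0 a ≤ x₁
      intoLowerMiddle : count (arc u) 0 m ≤ x₂
      total           : outdeg u ≤ x₃
  open QueryProfile

  lowerProfile : ∀ {u} → u < a → QueryProfile u ⌈ a /2⌉ ⌊ m /2⌋ lowerDeg
  lowerProfile {u} u<a = record
    { intoLower       = ≤-trans (arcCount-around 0 a (λ _ v<a → arc-lowerMiddle u<m (below-m v<a)) z≤n u<a)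
                                (⌊n/2⌋≤⌈n/2⌉ a)
    ; intoLowerMiddle = intoLowerMiddle′
    ; total           = begin
        count (arc u) 0 (m + b)            ≡⟨ count-++ (arc u) 0 m b ⟩
        count (arc u) 0 m + count (arc u) m b ≤⟨ +-mono-≤ intoLowerMiddle′ (count-≤ (arc u) m b) ⟩
        ⌊ m /2⌋ + b                        ∎
    }
    where
    open ≤-Reasoning
    below-m : ∀ {v} → v < a → v < m
    below-m v<a = <-≤-trans v<a (m≤m+n a L)
    u<m = below-m u<a
    intoLowerMiddle′ : count (arc u) 0 m ≤ ⌊ m /2⌋
    intoLowerMiddle′ = arcCount-around 0 m (λ _ v<m → arc-lowerMiddle u<m v<m) z≤n u<m

  middleProfile : ∀ {u} → a ≤ u → u < m → QueryProfile u ⌈ a /2⌉ ⌊ m /2⌋ middleDeg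
  middleProfile {u} a≤u u<m = record
    { intoLower       = arcCount-below 0 a agree a≤u
    ; intoLowerMiddle = arcCount-around 0 m agree z≤n u<m
    ; total           = arcCount-around 0 N agree z≤n (<-≤-trans u<m (m≤m+n m b))
    }
    where
    agree : ∀ {lo k v} → lo ≤ v → v < lo + k → arc u v ≡ alternating u v
    agree _ _ = arc-middle a≤u u<m

  upperProfile : ∀ {u} → m ≤ u → u < N → QueryProfile u 0 ⌈ L /2⌉ upperDeg
  upperProfile {u} m≤u u<N = record
    { intoLower       = ≤-reflexive none-lower
    ; intoLowerMiddle = begin
        count (arc u) 0 (a + L)             ≡⟨ count-++ (arc u) 0 a L ⟩
        count (arc u) 0 a + count (arc u) a L ≡⟨ cong (_+ count (arc u) a L) none-lower ⟩
        count (arc u) a L                   ≤⟨ arcCount-below a L (λ a≤v _ → arc-upper m≤u a≤v) m≤u ⟩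
        ⌈ L /2⌉                             ∎
    ; total           = begin
        count (arc u) 0 (a + L + b)         ≡⟨ cong (count (arc u) 0) (+-assoc a L b) ⟩
        count (arc u) 0 (a + (L + b))       ≡⟨ count-++ (arc u) 0 a (L + b) ⟩
        count (arc u) 0 a + count (arc u) a (L + b) ≡⟨ cong (_+ count (arc u) a (L + b)) none-lower ⟩
        count (arc u) a (L + b)             ≤⟨ arcCount-around a (L + b) (λ a≤v _ → arc-upper m≤u a≤v)
                                                 (≤-trans (m≤m+n a L) m≤u) (subst (u <_) (+-assoc a L b) u<N) ⟩
        ⌊ (L + b) /2⌋                       ∎
    }
    where
    open ≤-Reasoning
    none-lower : count (arc u) 0 a ≡ 0
    none-lower = trans (count-cong 0 a (λ _ v<a → arc-upper-lower m≤u v<a)) (count-const-false 0 a)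

  outs-split : ∀ u → outs u ≡ (filterᵇ (arc u) (interval 0 a) ++ filterᵇ (arc u) (interval a L))
                               ++ filterᵇ (arc u) (interval m b)
  outs-split u = trans (filterᵇ-interval-++ (arc u) 0 m b)
                       (cong (_++ filterᵇ (arc u) (interval m b)) (filterᵇ-interval-++ (arc u) 0 a L))

  rowCost-≤ : ∀ {u x₁ x₂ x₃} → QueryProfile u x₁ x₂ x₃ → queryCost 1 (outs u) ≤ rowBound x₁ x₂ x₃
  rowCost-≤ {u} P = subst (_≤ _) (cong (queryCost 1) (sym (outs-split u)))
    (queryCost-segments
      (filterᵇ (arc u) (interval 0 a)) (filterᵇ (arc u) (interval a L)) (filterᵇ (arc u) (interval m b))
      (λ v∈ → total (lowerProfile (proj₂ (∈-filterᵇ-interval⁻ 0 a v∈))))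
      (λ v∈ → let a≤v , v<m = ∈-filterᵇ-interval⁻ a L v∈ in total (middleProfile a≤v v<m))
      (λ v∈ → let m≤v , v<N = ∈-filterᵇ-interval⁻ m b v∈ in total (upperProfile m≤v v<N))
      (intoLower P)
      (subst (_≤ _) (cong length (filterᵇ-interval-++ (arc u) 0 a L)) (intoLowerMiddle P))
      (subst (_≤ _) (cong length (outs-split u)) (total P)))

  cost-threeTier-≤ : cost threeTier ≤ costBound
  cost-threeTier-≤ = cost-≤ row-≤
    where
    lower≤ : lowerRowBound ≤ costBound
    lower≤ = ≤-trans (m≤m⊔n lowerRowBound middleRowBound) (m≤m⊔n _ upperRowBound)
    middle≤ : middleRowBound ≤ costBound
    middle≤ = ≤-trans (m≤n⊔m lowerRowBound middleRowBound) (m≤m⊔n _ upperRowBound)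
    upper≤ : upperRowBound ≤ costBound
    upper≤ = m≤n⊔m (lowerRowBound ⊔ middleRowBound) upperRowBound
    row-≤ : ∀ u → u < N → queryCost 1 (outs u) ≤ costBound
    row-≤ u u<N with u <? a | u <? m
    ... | yes u<a | _       = ≤-trans (rowCost-≤ (lowerProfile u<a)) lower≤
    ... | no u≮a  | yes u<m = ≤-trans (rowCost-≤ (middleProfile (≮⇒≥ u≮a) u<m)) middle≤
    ... | no _    | no u≮m  = ≤-trans (rowCost-≤ (upperProfile (≮⇒≥ u≮m) u<N)) upper≤

⊔-step : ∀ c {x y x′ y′} → x′ ≤ c + x → y′ ≤ c + y → x′ ⊔ y′ ≤ c + (x ⊔ y)
⊔-step c {x} {y} x′≤ y′≤ = subst (_ ≤_) (sym (+-distribˡ-⊔ c x y)) (⊔-mono-≤ x′≤ y′≤)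

+-step : ∀ c d {x x′ D D′} → x′ ≤ c + x → D′ ≡ d + D → x′ + D′ ≤ (c + d) + (x + D)
+-step c d {x} {x′} {D} x′≤ D′≡ =
  ≤-trans (+-mono-≤ x′≤ (≤-reflexive D′≡)) (≤-reflexive (interchange c d x D))
  where
  interchange : ∀ c d x D → (c + x) + (d + D) ≡ (c + d) + (x + D)
  interchange = solve-∀

module TierSizesStep (b L : ℕ) where

  private
    module S = TierSizes b L
    module S′ = TierSizes (2 + b) (2 + L)

    a-step : ∀ b → (2 + b) + (2 + b) ≡ 4 + (b + b)
    a-step = solve-∀
    m-step : ∀ b L → (2 + b) + (2 + b) + (2 + L) ≡ 6 + (b + b + L)
    m-step = solve-∀
    N-step : ∀ b L → (2 + b) + (2 + b) + (2 + L) + (2 + b) ≡ 8 + (b + b + L + b)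
    N-step = solve-∀
    Lb-step : ∀ b L → (2 + L) + (2 + b) ≡ 4 + (L + b)
    Lb-step = solve-∀
    lowerDeg-step′ : ∀ h b → (3 + h) + (2 + b) ≡ 5 + (h + b)
    lowerDeg-step′ = solve-∀

  ⌈a/2⌉-step : ⌈ S′.a /2⌉ ≡ 2 + ⌈ S.a /2⌉
  ⌈a/2⌉-step = cong ⌈_/2⌉ (a-step b)

  ⌊m/2⌋-step : ⌊ S′.m /2⌋ ≡ 3 + ⌊ S.m /2⌋
  ⌊m/2⌋-step = cong ⌊_/2⌋ (m-step b L)

  lowerDeg-step : S′.lowerDeg ≡ 5 + S.lowerDeg
  lowerDeg-step = trans (cong (_+ (2 + b)) ⌊m/2⌋-step) (lowerDeg-step′ ⌊ S.m /2⌋ b)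

  middleDeg-step : S′.middleDeg ≡ 4 + S.middleDeg
  middleDeg-step = cong ⌊_/2⌋ (N-step b L)

  upperDeg-step : S′.upperDeg ≡ 2 + S.upperDeg
  upperDeg-step = cong ⌊_/2⌋ (Lb-step b L)

  rowBound-step : ∀ {x₁ x₂ x₃ y₁ y₂ y₃} → y₁ ≤ 2 + x₁ → y₂ ≤ 3 + x₂ → y₃ ≤ 5 + x₃ →
                  S′.rowBound y₁ y₂ y₃ ≤ 7 + S.rowBound x₁ x₂ x₃
  rowBound-step y₁≤ y₂≤ y₃≤ =
    ⊔-step 7 (⊔-step 7 (+-step 2 5 y₁≤ lowerDeg-step) (+-step 3 4 y₂≤ middleDeg-step))
             (+-step 5 2 y₃≤ upperDeg-step)

  costBound-step : S′.costBound ≤ 7 + S.costBound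
  costBound-step = ⊔-step 7 (⊔-step 7 lowerRow middleRow) upperRow
    where
    lowerRow : S′.lowerRowBound ≤ 7 + S.lowerRowBound
    lowerRow = rowBound-step (≤-reflexive ⌈a/2⌉-step) (≤-reflexive ⌊m/2⌋-step) (≤-reflexive lowerDeg-step)
    middleRow : S′.middleRowBound ≤ 7 + S.middleRowBound
    middleRow = rowBound-step (≤-reflexive ⌈a/2⌉-step) (≤-reflexive ⌊m/2⌋-step)
                              (≤-trans (≤-reflexive middleDeg-step) (n≤1+n _))
    upperRow : S′.upperRowBound ≤ 7 + S.upperRowBound
    upperRow = rowBound-step {0} {⌈ L /2⌉} {S.upperDeg} z≤n (s≤s (m≤n+m _ 2))
                             (≤-trans (≤-reflexive upperDeg-step) (+-monoˡ-≤ S.upperDeg (s≤s (s≤s z≤n))))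

costBound-scaled : ∀ b L t → TierSizes.costBound (2 * t + b) (2 * t + L) ≤ 7 * t + TierSizes.costBound b L
costBound-scaled b L zero    = ≤-refl
costBound-scaled b L (suc t) = begin
  TierSizes.costBound (2 * suc t + b) (2 * suc t + L)
    ≡⟨ cong₂ TierSizes.costBound (two-suc t b) (two-suc t L) ⟩
  TierSizes.costBound (2 + (2 * t + b)) (2 + (2 * t + L))
    ≤⟨ TierSizesStep.costBound-step (2 * t + b) (2 * t + L) ⟩
  7 + TierSizes.costBound (2 * t + b) (2 * t + L)
    ≤⟨ +-monoʳ-≤ 7 (costBound-scaled b L t) ⟩
  7 + (7 * t + TierSizes.costBound b L)
    ≡⟨ seven-suc t (TierSizes.costBound b L) ⟩
  7 * suc t + TierSizes.costBound b L ∎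
  where
  open ≤-Reasoning
  two-suc : ∀ t b → 2 * suc t + b ≡ 2 + (2 * t + b)
  two-suc = solve-∀
  seven-suc : ∀ t c → 7 + (7 * t + c) ≡ 7 * suc t + c
  seven-suc = solve-∀

size-scaled : ∀ t b L → TierSizes.N (2 * t + b) (2 * t + L) ≡ 8 * t + TierSizes.N b L
size-scaled = expand
  where
  expand : ∀ t b L → (2 * t + b) + (2 * t + b) + (2 * t + L) + (2 * t + b) ≡ 8 * t + (b + b + L + b)
  expand = solve-∀

BoundedAMS : ℕ → Set
BoundedAMS n = Σ (AMS n) (λ A → AtMostBound (cost A) n)

atMostBound? : ∀ c n → Dec (AtMostBound c n)
atMostBound? c n = (4 * c ≤? 5 * n) ×-dec (2 * (n * n) ≤? (5 * n ∸ 4 * c) * (5 * n ∸ 4 * c))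

-- With k = 5ρ ∸ 4f, the slack 5n ∸ 4c is at least 12t + k, and (12t + k)²
-- dominates 2(8t + ρ)² term by term; the hypothesis on ρ compares the terms linear in t.
atMostBound-scaled : ∀ {ρ f c} t → 4 * ρ ≤ 3 * (5 * ρ ∸ 4 * f) → AtMostBound f ρ →
                     c ≤ 7 * t + f → AtMostBound c (8 * t + ρ)
atMostBound-scaled {ρ} {f} {c} t margin (4f≤5ρ , 2ρ²≤k²) c≤K = 4c≤5n , 2n²≤slack²
  where
  open ≤-Reasoning
  k = 5 * ρ ∸ 4 * f
  n = 8 * t + ρ
  K = 7 * t + f

  distrib : ∀ t ρ → 5 * (8 * t + ρ) ≡ 40 * t + 5 * ρ
  distrib = solve-∀
  regroup : ∀ t f k → 40 * t + (4 * f + k) ≡ 4 * (7 * t + f) + (12 * t + k)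
  regroup = solve-∀
  square-n : ∀ t ρ → 2 * ((8 * t + ρ) * (8 * t + ρ)) ≡ 128 * (t * t) + 8 * t * (4 * ρ) + 2 * (ρ * ρ)
  square-n = solve-∀
  square-slack : ∀ t k → (12 * t + k) * (12 * t + k) ≡ 144 * (t * t) + 8 * t * (3 * k) + k * k
  square-slack = solve-∀

  5n≡4K+slack : 5 * n ≡ 4 * K + (12 * t + k)
  5n≡4K+slack = begin-equality
    5 * (8 * t + ρ)      ≡⟨ distrib t ρ ⟩
    40 * t + 5 * ρ       ≡⟨ cong (40 * t +_) (sym (m+[n∸m]≡n 4f≤5ρ)) ⟩
    40 * t + (4 * f + k) ≡⟨ regroup t f k ⟩
    4 * K + (12 * t + k) ∎

  4c≤4K : 4 * c ≤ 4 * K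
  4c≤4K = *-monoʳ-≤ 4 c≤K

  4c≤5n : 4 * c ≤ 5 * n
  4c≤5n = ≤-trans 4c≤4K (≤-trans (m≤m+n (4 * K) _) (≤-reflexive (sym 5n≡4K+slack)))

  slack : 12 * t + k ≤ 5 * n ∸ 4 * c
  slack = begin
    12 * t + k                   ≡⟨ sym (m+n∸m≡n (4 * K) _) ⟩
    4 * K + (12 * t + k) ∸ 4 * K ≡⟨ cong (_∸ 4 * K) (sym 5n≡4K+slack) ⟩
    5 * n ∸ 4 * K                ≤⟨ ∸-monoʳ-≤ (5 * n) 4c≤4K ⟩
    5 * n ∸ 4 * c                ∎

  2n²≤slack² : 2 * (n * n) ≤ (5 * n ∸ 4 * c) * (5 * n ∸ 4 * c)
  2n²≤slack² = begin
    2 * (n * n)                                   ≡⟨ square-n t ρ ⟩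
    128 * (t * t) + 8 * t * (4 * ρ) + 2 * (ρ * ρ) ≤⟨ +-mono-≤ (+-mono-≤ (*-monoˡ-≤ (t * t) (m≤m+n 128 16))
                                                                        (*-monoʳ-≤ (8 * t) margin)) 2ρ²≤k² ⟩
    144 * (t * t) + 8 * t * (3 * k) + k * k       ≡⟨ sym (square-slack t k) ⟩
    (12 * t + k) * (12 * t + k)                   ≤⟨ *-mono-≤ slack slack ⟩
    (5 * n ∸ 4 * c) * (5 * n ∸ 4 * c)             ∎

scaledThreeTier : ∀ b L → let open TierSizes b L in
                  4 * N ≤ 3 * (5 * N ∸ 4 * costBound) → AtMostBound costBound N →
                  ∀ t → BoundedAMS (8 * t + N)
scaledThreeTier b L margin base t =
  subst BoundedAMS (size-scaled t b L) (A , subst (AtMostBound (cost A)) (sym (size-scaled t b L)) A-bound)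
  where
  A = ThreeTier.threeTier (2 * t + b) (2 * t + L)
  A-bound : AtMostBound (cost A) (8 * t + TierSizes.N b L)
  A-bound = atMostBound-scaled t margin base
    (≤-trans (ThreeTier.cost-threeTier-≤ (2 * t + b) (2 * t + L)) (costBound-scaled b L t))

scaledByComputation : ∀ b L → let open TierSizes b L in
       {True (4 * N ≤? 3 * (5 * N ∸ 4 * costBound))} → {True (atMostBound? costBound N)} →
       ∀ t → BoundedAMS (8 * t + N)
scaledByComputation b L {margin} {base} = scaledThreeTier b L (toWitness margin) (toWitness base)

byComputation : ∀ b L → {True (atMostBound? (cost (ThreeTier.threeTier b L)) (TierSizes.N b L))} →
              BoundedAMS (TierSizes.N b L)
byComputation b L {ok} = ThreeTier.threeTier b L , toWitness ok

reindex : ∀ {t r} → BoundedAMS (8 * t + (8 + r)) → BoundedAMS (8 * suc t + r)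
reindex {t} {r} = subst BoundedAMS (regroup t r)
  where
  regroup : ∀ t r → 8 * t + (8 + r) ≡ 8 * suc t + r
  regroup = solve-∀

-- For n = 2, 3 and 10 costBound is too weak, and the exact cost is computed instead.
byResidue : ∀ q r → r < 8 → 2 ≤ 8 * q + r → BoundedAMS (8 * q + r)
byResidue zero          0 _ ()
byResidue zero          1 _ (s≤s ())
byResidue (suc t)       0 _ _ = reindex {t} (scaledByComputation 2 2 t)
byResidue (suc t)       1 _ _ = reindex {t} (scaledByComputation 2 3 t)
byResidue zero          2 _ _ = byComputation 0 2
byResidue 1             2 _ _ = byComputation 2 4
byResidue (suc (suc t)) 2 _ _ = reindex {suc t} (reindex {t} (scaledByComputation 4 6 t))
byResidue zero          3 _ _ = byComputation 0 3
byResidue (suc t)       3 _ _ = reindex {t} (scaledByComputation 2 5 t)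
byResidue q             4 _ _ = scaledByComputation 1 1 q
byResidue q             5 _ _ = scaledByComputation 1 2 q
byResidue q             6 _ _ = scaledByComputation 1 3 q
byResidue q             7 _ _ = scaledByComputation 1 4 q
byResidue q (suc (suc (suc (suc (suc (suc (suc (suc r)))))))) r<8 _ = contradiction r<8 (m+n≮m 8 r)

theorem3 : (n : ℕ) → n ≥ 2 → Σ (AMS n) (λ A → AtMostBound (cost A) n)
theorem3 n n≥2 =
  subst BoundedAMS (sym n≡8q+r) (byResidue (n / 8) (n % 8) (m%n<n n 8) (subst (2 ≤_) n≡8q+r n≥2))
  where
  n≡8q+r : n ≡ 8 * (n / 8) + n % 8
  n≡8q+r = trans (m≡m%n+[m/n]*n n 8) (trans (+-comm (n % 8) _) (cong (_+ n % 8) (*-comm (n / 8) 8)))
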